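{- Let $G$ be a finite planar graph (fixed embedding) without leaves, containing no proper contractible subset of bounded faces, with $e_G=3f_G$. Let $\varphi,\varphi'$ be edge-injective functions on $G$. Then the orientation $G^\star_\varphi$ can be obtained from $G^\star_{\varphi'}$ by successively reversing directed cycles (at each step, reversing all arcs of a directed cycle of the current orientation).
   Context: $e_G,f_G$: numbers of edges and bounded faces. For a set $S$ of bounded faces, $e_S$ is the number of edges lying on faces of $S$ and $f_S=|S|$; a nonempty $S$ is contractible if $e_S\leqslant 3f_S$, proper if not all bounded faces. An edge-injective function is a map $\varphi$ from bounded faces to 3-element sets of edges with $\varphi(F)$ contained in the boundary of $F$ and $\varphi(F)\cap\varphi(F')=\emptyset$ for $F\neq F'$ (when $e_G=3f_G$ it uses every edge). The modified dual $G^\star$ has a vertex for each bounded face of $G$, an edge between $F$ and $F'$ for each edge of $G$ shared by $F$ and $F'$, and a loop at $F$ for each edge of $G$ lying on exactly one bounded face $F$. $G^\star_\varphi$ is the orientation of $G^\star$ in which the edge corresponding to $e\in\varphi(F)$ is directed toward $F$; every vertex then has exactly three incoming edges. -}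

module Defs where

open import Data.Nat using (ℕ; zero; suc; _+_; _*_; _≤_)
open import Data.Bool using (Bool; true; false; if_then_else_; T)
open import Data.Fin using (Fin; zero; suc; inject₁; fromℕ) renaming (_≟_ to _≟F_)
open import Data.Product using (Σ; ∃; ∃-syntax; _×_; _,_; proj₁; proj₂)
open import Data.Sum using (_⊎_)
open import Relation.Nullary using (¬_; does)
open import Relation.Binary.PropositionalEquality using (_≡_; _≢_)
open import Relation.Binary.Construct.Closure.ReflexiveTransitive using (Star)

sumFin : {k : ℕ} → (Fin k → ℕ) → ℕ
sumFin {zero}  f = 0
sumFin {suc k} f = f zero + sumFin (λ i → f (suc i))

count : {k : ℕ} → (Fin k → Bool) → ℕ
count p = sumFin (λ i → if p i then 1 else 0)

anyFin : {k : ℕ} → (Fin k → Bool) → Bool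
anyFin {zero}  p = false
anyFin {suc k} p = if p zero then true else anyFin (λ i → p (suc i))

-- A finite plane graph, recorded through the combinatorial data the
-- statement depends on: vertices, edges (with endpoints), bounded faces,
-- and which edges lie on (the boundary of) which bounded face.

record PlaneGraph : Set where
  field
    nV nE nF : ℕ
    ends     : Fin nE → Fin nV × Fin nV
    onFace   : Fin nE → Fin nF → Bool
    atMostTwo : ∀ e F₁ F₂ F₃ → T (onFace e F₁) → T (onFace e F₂) → T (onFace e F₃) →
                F₁ ≡ F₂ ⊎ F₁ ≡ F₃ ⊎ F₂ ≡ F₃

module _ (G : PlaneGraph) where
  open PlaneGraph G

  -- degree of a vertex (a loop counts twice)
  degree : Fin nV → ℕ
  degree x = sumFin (λ e → (if does (proj₁ (ends e) ≟F x) then 1 else 0)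
                         + (if does (proj₂ (ends e) ≟F x) then 1 else 0))

  NoLeaves : Set
  NoLeaves = ∀ x → degree x ≢ 1

  FaceSet : Set
  FaceSet = Fin nF → Bool

  f[_] : FaceSet → ℕ
  f[ S ] = count S

  e[_] : FaceSet → ℕ
  e[ S ] = count (λ e → anyFin (λ F → if S F then onFace e F else false))

  Nonempty : FaceSet → Set
  Nonempty S = ∃[ F ] T (S F)

  Proper : FaceSet → Set
  Proper S = ∃[ F ] ¬ T (S F)

  Contractible : FaceSet → Set
  Contractible S = Nonempty S × e[ S ] ≤ 3 * f[ S ]

  NoProperContractible : Set
  NoProperContractible = ∀ S → Proper S → ¬ Contractible S

  -- edge-injective function: each face F gets three edges φ F 0, φ F 1, φ F 2
  -- of its boundary; injectivity of (F , i) ↦ φ F i says these are three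
  -- distinct edges and the sets for distinct faces are disjoint.
  record EdgeInjective : Set where
    field
      φ        : Fin nF → Fin 3 → Fin nE
      onBdry   : ∀ F i → T (onFace (φ F i) F)
      injective : ∀ F i F′ i′ → φ F i ≡ φ F′ i′ → F ≡ F′ × i ≡ i′

  _∈φ_ : Fin nE → EdgeInjective × Fin nF → Set
  e ∈φ (ψ , F) = ∃[ i ] EdgeInjective.φ ψ F i ≡ e

  -- The edges of G⋆ are the edges of G;
  -- the edge e joins the bounded faces containing it (a loop if there is just
  -- one).  An orientation is given by the head of each edge.
  Orientation : Set
  Orientation = Fin nE → Fin nF

  Arc : Orientation → Fin nE → Fin nF → Fin nF → Set
  Arc h e F F′ = h e ≡ F′ × T (onFace e F) × T (onFace e F′) ×
                 (F ≡ F′ → ∀ F″ → T (onFace e F″) → F″ ≡ F)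

  -- h is the orientation G⋆_φ: the edge of e ∈ φ(F) is directed toward F
  -- (every edge is in some φ(F) when e_G = 3 f_G)
  IsDualOrientation : EdgeInjective → Orientation → Set
  IsDualOrientation ψ h = ∀ e F → e ∈φ (ψ , F) → h e ≡ F

  -- a directed cycle of length k ≥ 1 in orientation h: distinct vertices
  -- vs 0 … vs (k-1) (vs k = vs 0), distinct arcs es i : vs i → vs (i+1)
  record DirectedCycle (h : Orientation) : Set where
    field
      len   : ℕ
      vs    : Fin (suc (suc len)) → Fin nF
      es    : Fin (suc len) → Fin nE
      closed : vs (fromℕ (suc len)) ≡ vs zero
      vs-inj : ∀ i j → vs (inject₁ i) ≡ vs (inject₁ j) → i ≡ j
      es-inj : ∀ i j → es i ≡ es j → i ≡ j
      arcs   : ∀ i → Arc h (es i) (vs (inject₁ i)) (vs (suc i))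

  ReverseStep : Orientation → Orientation → Set
  ReverseStep h h′ = Σ (DirectedCycle h) λ C →
    let open DirectedCycle C in
    (∀ i → h′ (es i) ≡ vs (inject₁ i)) ×
    (∀ e → (∀ i → es i ≢ e) → h′ e ≡ h e)

  ObtainableByCycleReversals : Orientation → Orientation → Set
  ObtainableByCycleReversals h₁ h₂ =
    ∃[ h ] (Star ReverseStep h₁ h × (∀ e → h e ≡ h₂ e))

{-# OPTIONS --safe #-}
module Submission where

-- G⋆_φ and G⋆_φ′ give every face in-degree 3, so the heads of the two orientations agree up to a
-- permutation π of the edges (h′ ∘ π = h). While such an orientation g differs from h, pick an edge
-- with h-head B and another g-head, and walk along its g-arc; at the face reached, equal in-degrees
-- provide another such edge, so the walk never stops and closes up into a directed cycle of g.
-- Reversing that cycle makes g agree with h on it and keeps its heads a permutation of those of h,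
-- so the number of disagreeing edges drops.

open import Defs
open import Data.Nat using (ℕ; zero; suc; _+_; _*_; _≤_; _<_; z≤n; s≤s; s≤s⁻¹)
open import Data.Nat.Properties
  using ( +-comm; +-suc; +-mono-≤; +-mono-<-≤; +-mono-≤-<; +-monoʳ-<; *-comm; ≤-trans; ≤∧≢⇒<; <-cmp; <-irrefl
        ; n<1+n; m≤n⇒∃[o]m+o≡n; +-0-commutativeMonoid)
import Data.Nat.Properties as ℕ
open import Data.Bool using (Bool; true; false; T; if_then_else_)
open import Data.Bool.Properties using (T?)
open import Data.Empty using (⊥-elim)
open import Data.Fin using (Fin; zero; suc; toℕ; fromℕ<; inject₁; punchOut; remQuot)
open import Data.Fin.Properties
  using ( _≟_; any?; pigeonhole; punchOut-injective; injective⇒≤; toℕ<n; toℕ-injective; toℕ-inject₁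
        ; toℕ-fromℕ; toℕ-fromℕ<; *↔×)
open import Data.Fin.Permutation using (Permutation)
open import Data.Product using (Σ-syntax; ∃-syntax; _×_; _,_; proj₁; proj₂; uncurry; map; map₂)
open import Function using (_∘_; id)
open import Function.Bundles using (Injection; mk↔ₛ′)
open import Function.Definitions using (Injective)
import Function.Endo.Propositional as Endo
open import Function.Properties.Inverse using (↔⇒↣)
open import Relation.Nullary using (¬_; Dec; yes; no; ¬?; _×-dec_)
open import Relation.Nullary.Decidable
  using (isYes; isNo; toWitness; fromWitness; toWitnessFalse; fromWitnessFalse; decidable-stable)
open import Relation.Unary using (Decidable)
open import Relation.Binary.Definitions using (tri<; tri≈; tri>)
open import Relation.Binary.PropositionalEquality
open import Relation.Binary.Construct.Closure.ReflexiveTransitive using (ε; _◅_)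
open import Algebra.Properties.CommutativeMonoid.Sum +-0-commutativeMonoid using (sum; sum-permute)

indicator : Bool → ℕ
indicator b = if b then 1 else 0

indicator-mono : {a b : Bool} → (T b → T a) → indicator b ≤ indicator a
indicator-mono {a}     {false} _   = z≤n
indicator-mono {true}  {true}  _   = s≤s z≤n
indicator-mono {false} {true}  b⇒a = ⊥-elim (b⇒a _)

indicator-< : {a b : Bool} → T a → ¬ T b → indicator b < indicator a
indicator-< {true} {false} _ _  = s≤s z≤n
indicator-< {true} {true}  _ ¬b = ⊥-elim (¬b _)

count-mono : ∀ {k} {P Q : Fin k → Bool} → (∀ i → T (Q i) → T (P i)) → count Q ≤ count P
count-mono {zero}  Q⇒P = z≤n
count-mono {suc k} Q⇒P = +-mono-≤ (indicator-mono (Q⇒P zero)) (count-mono (Q⇒P ∘ suc))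

count-< : ∀ {k} {P Q : Fin k → Bool} → (∀ i → T (Q i) → T (P i)) →
          ∀ d → T (P d) → ¬ T (Q d) → count Q < count P
count-< Q⇒P zero    Pd ¬Qd = +-mono-<-≤ (indicator-< Pd ¬Qd) (count-mono (Q⇒P ∘ suc))
count-< Q⇒P (suc d) Pd ¬Qd = +-mono-≤-< (indicator-mono (Q⇒P zero)) (count-< (Q⇒P ∘ suc) d Pd ¬Qd)

count-exchange : ∀ {k} {P Q : Fin k → Bool} → count P ≡ count Q →
                 ∀ d → T (P d) → ¬ T (Q d) → ∃[ d′ ] T (Q d′) × ¬ T (P d′)
count-exchange {P = P} {Q} P≡Q d Pd ¬Qd with any? (λ i → T? (Q i) ×-dec ¬? (T? (P i)))
... | yes found = found
... | no none   = ⊥-elim (<-irrefl (sym P≡Q) (count-< Q⇒P d Pd ¬Qd))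
  where
  Q⇒P : ∀ i → T (Q i) → T (P i)
  Q⇒P i Qi with T? (P i)
  ... | yes Pi = Pi
  ... | no ¬Pi = ⊥-elim (none (i , Qi , ¬Pi))

injective⇒surjective : ∀ {m n} → m ≡ n → {f : Fin m → Fin n} → Injective _≡_ _≡_ f →
                       ∀ y → ∃[ x ] f x ≡ y
injective⇒surjective {suc n} refl {f} f-inj y with any? (λ x → f x ≟ y)
... | yes hit = hit
... | no miss = ⊥-elim (<-irrefl refl (injective⇒≤ g-inj))
  where
  -- deleting the missed value y turns f into an injection Fin (suc n) → Fin n
  y≢f : ∀ x → y ≢ f x
  y≢f x y≡fx = miss (x , sym y≡fx)
  g : Fin (suc n) → Fin n
  g x = punchOut (y≢f x)
  g-inj : Injective _≡_ _≡_ g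
  g-inj {a} {b} eq = f-inj (punchOut-injective (y≢f a) (y≢f b) eq)

sumFin≡sum : ∀ {k} (f : Fin k → ℕ) → sumFin f ≡ sum f
sumFin≡sum {zero}  f = refl
sumFin≡sum {suc k} f = cong (f zero +_) (sumFin≡sum (f ∘ suc))

sumFin-reindex : ∀ {k} (f : Fin k → ℕ) {π : Fin k → Fin k} → Injective _≡_ _≡_ π →
                 sumFin (f ∘ π) ≡ sumFin f
sumFin-reindex f {π} π-inj = begin
  sumFin (f ∘ π) ≡⟨ sumFin≡sum (f ∘ π) ⟩
  sum (f ∘ π)    ≡⟨ sum-permute f permutation ⟨
  sum f          ≡⟨ sumFin≡sum f ⟨
  sumFin f       ∎
  where
  open ≡-Reasoning
  π-onto = injective⇒surjective refl π-inj
  permutation : Permutation _ _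
  permutation = mk↔ₛ′ π (proj₁ ∘ π-onto) (proj₂ ∘ π-onto) (λ x → π-inj (proj₂ (π-onto (π x))))

sumFin-cong : ∀ {k} {f g : Fin k → ℕ} → (∀ i → f i ≡ g i) → sumFin f ≡ sumFin g
sumFin-cong {zero}  f≗g = refl
sumFin-cong {suc k} f≗g = cong₂ _+_ (f≗g zero) (sumFin-cong (f≗g ∘ suc))

minimal-witness : {P : ℕ → Set} → Decidable P → ∀ {n} → P n →
                  ∃[ m ] P m × (∀ {k} → k < m → ¬ P k)
minimal-witness P? {zero} Pn = zero , Pn , λ ()
minimal-witness P? {suc n} Pn with P? zero
... | yes P0 = zero , P0 , λ ()
... | no ¬P0 with m , Pm , below ← minimal-witness (P? ∘ suc) Pn =
  suc m , Pm , λ { {zero} _ → ¬P0 ; {suc k} k<m → below (s≤s⁻¹ k<m) }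

module _ {n : ℕ} (f : Fin n → Fin n) where

  open Endo (Fin n) using (_^_; ^-homo)

  ^-+ : ∀ a b x → (f ^ (a + b)) x ≡ (f ^ a) ((f ^ b) x)
  ^-+ a b x = cong-app (^-homo f a b) x

  record Cycle : Set where
    field
      start    : Fin n
      len      : ℕ
      returns  : (f ^ suc len) start ≡ start
      distinct : ∀ {a b} → a ≤ len → b ≤ len → (f ^ a) start ≡ (f ^ b) start → a ≡ b

    point : ℕ → Fin n
    point m = (f ^ m) start

    point-wraps : ∀ m → ∃[ k ] point (toℕ {suc len} k) ≡ point m
    point-wraps zero = zero , refl
    point-wraps (suc m) with k , k≈m ← point-wraps m with toℕ k ℕ.≟ len
    ... | yes k≡len = zero , sym (trans (cong f (trans (sym k≈m) (cong point k≡len))) returns)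
    ... | no  k≢len = fromℕ< k+1<1+len , trans (cong point (toℕ-fromℕ< k+1<1+len)) (cong f k≈m)
      where
      k+1<1+len : suc (toℕ k) < suc len
      k+1<1+len = s≤s (≤∧≢⇒< (s≤s⁻¹ (toℕ<n k)) k≢len)

    point-suc-injective : ∀ {a b} → point (suc a) ≡ point (suc b) → point a ≡ point b
    point-suc-injective {a} {b} eq = trans (sym (back a)) (trans (cong (f ^ len) eq) (back b))
      where
      back : ∀ a → (f ^ len) (point (suc a)) ≡ point a
      back a = begin
        (f ^ len) (point (suc a))  ≡⟨ ^-+ len (suc a) start ⟨
        (f ^ (len + suc a)) start  ≡⟨ cong (λ k → (f ^ k) start) (trans (+-comm len (suc a)) (sym (+-suc a len))) ⟩
        (f ^ (a + suc len)) start  ≡⟨ ^-+ a (suc len) start ⟩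
        (f ^ a) ((f ^ suc len) start) ≡⟨ cong (f ^ a) returns ⟩
        point a ∎
        where open ≡-Reasoning

  periodic-point-cycle : ∀ y {p} → (f ^ suc p) y ≡ y → Σ[ C ∈ Cycle ] Cycle.start C ≡ y
  periodic-point-cycle y {p} returns
    with len , returns′ , minimal ← minimal-witness (λ q → (f ^ suc q) y ≟ y) {p} returns =
    record { start = y ; len = len ; returns = returns′ ; distinct = distinct } , refl
    where
    -- a repetition f^a y = f^b y with a < b ≤ len would give the earlier return time s + a
    no-repetition : ∀ {a b} → a < b → b ≤ len → (f ^ a) y ≢ (f ^ b) y
    no-repetition {a} {b} a<b b≤len eq with s , b+s≡len ← m≤n⇒∃[o]m+o≡n b≤len =
      minimal earlier returns-earlier
      where
      earlier : s + a < len
      earlier = subst (s + a <_) (trans (+-comm s b) b+s≡len) (+-monoʳ-< s a<b)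
      returns-earlier : (f ^ suc (s + a)) y ≡ y
      returns-earlier = begin
        (f ^ (suc s + a)) y       ≡⟨ ^-+ (suc s) a y ⟩
        (f ^ suc s) ((f ^ a) y)   ≡⟨ cong (f ^ suc s) eq ⟩
        (f ^ suc s) ((f ^ b) y)   ≡⟨ ^-+ (suc s) b y ⟨
        (f ^ (suc s + b)) y       ≡⟨ cong (λ k → (f ^ suc k) y) (trans (+-comm s b) b+s≡len) ⟩
        (f ^ suc len) y           ≡⟨ returns′ ⟩
        y                         ∎
        where open ≡-Reasoning
    distinct : ∀ {a b} → a ≤ len → b ≤ len → (f ^ a) y ≡ (f ^ b) y → a ≡ b
    distinct {a} {b} a≤len b≤len eq with <-cmp a b
    ... | tri< a<b _ _ = ⊥-elim (no-repetition a<b b≤len eq)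
    ... | tri≈ _ a≡b _ = a≡b
    ... | tri> _ _ b<a = ⊥-elim (no-repetition b<a a≤len (sym eq))

  cycle-in-orbit : ∀ x → Σ[ C ∈ Cycle ] ∃[ i ] Cycle.start C ≡ (f ^ i) x
  cycle-in-orbit x
    with i , j , i<j , fⁱx≡fʲx ← pigeonhole (n<1+n n) (λ k → (f ^ toℕ k) x)
    with o , i+1+o≡j ← m≤n⇒∃[o]m+o≡n i<j =
    map₂ (toℕ i ,_) (periodic-point-cycle ((f ^ toℕ i) x) {o} returns)
    where
    returns : (f ^ suc o) ((f ^ toℕ i) x) ≡ (f ^ toℕ i) x
    returns = begin
      (f ^ suc o) ((f ^ toℕ i) x)  ≡⟨ ^-+ (suc o) (toℕ i) x ⟨
      (f ^ (suc o + toℕ i)) x      ≡⟨ cong (λ k → (f ^ suc k) x) (+-comm o (toℕ i)) ⟩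
      (f ^ (suc (toℕ i) + o)) x    ≡⟨ cong (λ k → (f ^ k) x) i+1+o≡j ⟩
      (f ^ toℕ j) x                ≡⟨ fⁱx≡fʲx ⟨
      (f ^ toℕ i) x                ∎
      where open ≡-Reasoning

module _ (G : PlaneGraph) where
  open PlaneGraph G

  Admissible : Orientation G → Set
  Admissible g = ∀ e → T (onFace e (g e))

  Rearrangement : Orientation G → Orientation G → Set
  Rearrangement g h = Σ[ π ∈ (Fin nE → Fin nE) ] Injective _≡_ _≡_ π × (∀ e → g (π e) ≡ h e)

  rearrangement-trans : ∀ {g₁ g₂ g₃} → Rearrangement g₁ g₂ → Rearrangement g₂ g₃ → Rearrangement g₁ g₃
  rearrangement-trans (σ , σ-inj , σ-ok) (π , π-inj , π-ok) =
    σ ∘ π , π-inj ∘ σ-inj , λ e → trans (σ-ok (π e)) (π-ok e)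

  indegree : Orientation G → Fin nF → ℕ
  indegree g B = count (λ e → isYes (g e ≟ B))

  rearrangement⇒indegree≡ : ∀ {g h} → Rearrangement g h → ∀ B → indegree g B ≡ indegree h B
  rearrangement⇒indegree≡ {g} {h} (π , π-inj , π-ok) B = begin
    sumFin (arrivesIn g)       ≡⟨ sumFin-reindex (arrivesIn g) π-inj ⟨
    sumFin (arrivesIn g ∘ π)   ≡⟨ sumFin-cong (λ e → cong (λ F → indicator (isYes (F ≟ B))) (π-ok e)) ⟩
    sumFin (arrivesIn h)       ∎
    where
    open ≡-Reasoning
    arrivesIn : Orientation G → Fin nE → ℕ
    arrivesIn g e = indicator (isYes (g e ≟ B))

  module Reversals (h : Orientation G) (h-admissible : Admissible h) where

    Deficit : Orientation G → Fin nF → Set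
    Deficit g B = ∃[ e ] h e ≡ B × g e ≢ B

    surplus⇒deficit : ∀ {g} → Rearrangement g h → ∀ {d B} → g d ≡ B → h d ≢ B → Deficit g B
    surplus⇒deficit {g} g≈h {d} {B} gd≡B hd≢B
      with d′ , hd′≡B , gd′≢B ← count-exchange {P = λ e → isYes (g e ≟ B)} {Q = λ e → isYes (h e ≟ B)}
                                   (rearrangement⇒indegree≡ g≈h B) d (fromWitness gd≡B) (hd≢B ∘ toWitness)
      = d′ , toWitness hd′≡B , gd′≢B ∘ fromWitness

    disagreements : Orientation G → ℕ
    disagreements g = count (λ e → isNo (g e ≟ h e))

    module Step (g : Orientation G) (g-admissible : Admissible g) (g≈h : Rearrangement g h)
                (e₀ : Fin nE) (e₀-differs : g e₀ ≢ h e₀) where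
      open Endo (Fin nF) using (_^_)

      deficit? : ∀ B → Dec (Deficit g B)
      deficit? B = any? (λ e → (h e ≟ B) ×-dec ¬? (g e ≟ B))

      -- e₀ is only a default: out is used at deficit faces only
      out : Fin nF → Fin nE
      out B with deficit? B
      ... | yes (e , _) = e
      ... | no _        = e₀

      out-deficit : ∀ {B} → Deficit g B → h (out B) ≡ B × g (out B) ≢ B
      out-deficit {B} deficit with deficit? B
      ... | yes (_ , witness) = witness
      ... | no no-deficit     = ⊥-elim (no-deficit deficit)

      next : Fin nF → Fin nF
      next B = g (out B)

      next-deficit : ∀ {B} → Deficit g B → Deficit g (next B)
      next-deficit deficit with h-out≡B , g-out≢B ← out-deficit deficit =
        surplus⇒deficit g≈h refl (λ h-out≡g-out → g-out≢B (trans (sym h-out≡g-out) h-out≡B))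

      iterate-deficit : ∀ {B} → Deficit g B → ∀ i → Deficit g ((next ^ i) B)
      iterate-deficit deficit zero    = deficit
      iterate-deficit deficit (suc i) = next-deficit (iterate-deficit deficit i)

      -- opaque, so that with-abstractions below do not unfold the pigeonhole search
      opaque
        orbit-cycle : Σ[ C ∈ Cycle next ] ∃[ i ] Cycle.start C ≡ (next ^ i) (h e₀)
        orbit-cycle = cycle-in-orbit next (h e₀)

      open Cycle (proj₁ orbit-cycle)

      point-deficit : ∀ m → Deficit g (point m)
      point-deficit m with i , start≡ ← proj₂ orbit-cycle =
        subst (Deficit g) (trans (^-+ next m i (h e₀)) (cong (next ^ m) (sym start≡)))
          (iterate-deficit (e₀ , refl , e₀-differs) (m + i))

      vertex : Fin (suc (suc len)) → Fin nF
      vertex k = point (toℕ k)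

      edge : Fin (suc len) → Fin nE
      edge k = out (point (toℕ k))

      vertex-inject₁ : ∀ k → vertex (inject₁ k) ≡ point (toℕ k)
      vertex-inject₁ k = cong point (toℕ-inject₁ k)

      h-out-point : ∀ m → h (out (point m)) ≡ point m
      h-out-point m = proj₁ (out-deficit (point-deficit m))

      g-edge≢ : ∀ k → g (edge k) ≢ point (toℕ k)
      g-edge≢ k = proj₂ (out-deficit (point-deficit (toℕ k)))

      distinct-index : ∀ {i j : Fin (suc len)} → point (toℕ i) ≡ point (toℕ j) → i ≡ j
      distinct-index {i} {j} eq = toℕ-injective (distinct (s≤s⁻¹ (toℕ<n i)) (s≤s⁻¹ (toℕ<n j)) eq)

      cycle : DirectedCycle G g
      cycle = record
        { len    = len
        ; vs     = vertex
        ; es     = edge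
        ; closed = trans (cong point (toℕ-fromℕ (suc len))) returns
        ; vs-inj = λ i j eq → distinct-index (trans (sym (vertex-inject₁ i)) (trans eq (vertex-inject₁ j)))
        ; es-inj = λ i j eq → distinct-index
                     (trans (sym (h-out-point (toℕ i))) (trans (cong h eq) (h-out-point (toℕ j))))
        ; arcs   = λ i → refl
                       , subst (T ∘ onFace (edge i)) (trans (h-out-point (toℕ i)) (sym (vertex-inject₁ i)))
                           (h-admissible (edge i))
                       , g-admissible (edge i)
                       , λ loop → ⊥-elim (g-edge≢ i (sym (trans (sym (vertex-inject₁ i)) loop)))
        }

      OnCycle : Fin nE → Set
      OnCycle e = ∃[ k ] edge k ≡ e

      onCycle? : ∀ e → Dec (OnCycle e)
      onCycle? e = any? (λ k → edge k ≟ e)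

      out-point-on-cycle : ∀ m → OnCycle (out (point m))
      out-point-on-cycle m with k , point-k≡point-m ← point-wraps m = k , cong out point-k≡point-m

      reversed : Orientation G
      reversed e = if isYes (onCycle? e) then h e else g e

      reversed-on : ∀ {e} → OnCycle e → reversed e ≡ h e
      reversed-on {e} on with onCycle? e
      ... | yes _  = refl
      ... | no off = ⊥-elim (off on)

      reversed-off : ∀ {e} → ¬ OnCycle e → reversed e ≡ g e
      reversed-off {e} off with onCycle? e
      ... | yes on = ⊥-elim (off on)
      ... | no _   = refl

      reversal-step : ReverseStep G g reversed
      reversal-step =
        cycle
        , (λ i → trans (reversed-on (i , refl)) (trans (h-out-point (toℕ i)) (sym (vertex-inject₁ i))))
        , (λ e off → reversed-off (λ (k , edge-k≡e) → off k edge-k≡e))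

      -- the edge of the cycle into point (k + 1) changes from edge k to edge (k + 1)
      rotate : Fin nE → Fin nE
      rotate e = if isYes (onCycle? e) then out (g e) else e

      rotate-injective : Injective _≡_ _≡_ rotate
      rotate-injective {a} {b} eq with onCycle? a | onCycle? b
      ... | yes (k , refl) | yes (k′ , refl) =
        cong edge (distinct-index {k} {k′} (point-suc-injective {toℕ k} {toℕ k′}
          (trans (sym (h-out-point (suc (toℕ k)))) (trans (cong h eq) (h-out-point (suc (toℕ k′)))))))
      ... | yes (k , refl) | no off = ⊥-elim (off (subst OnCycle eq (out-point-on-cycle (suc (toℕ k)))))
      ... | no off | yes (k , refl) = ⊥-elim (off (subst OnCycle (sym eq) (out-point-on-cycle (suc (toℕ k)))))
      ... | no _   | no _           = eq

      reversed-rotate : ∀ e → reversed (rotate e) ≡ g e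
      reversed-rotate e with onCycle? e
      ... | yes (k , refl) =
        trans (reversed-on (out-point-on-cycle (suc (toℕ k)))) (h-out-point (suc (toℕ k)))
      ... | no off         = reversed-off off

      reversed≈g : Rearrangement reversed g
      reversed≈g = rotate , rotate-injective , reversed-rotate

      fewer-disagreements : disagreements reversed < disagreements g
      fewer-disagreements =
        count-< still-differs (edge zero)
          (fromWitnessFalse (λ g≡h → g-edge≢ zero (trans g≡h (h-out-point 0))))
          (λ differs → toWitnessFalse differs (reversed-on (zero , refl)))
        where
        still-differs : ∀ e → T (isNo (reversed e ≟ h e)) → T (isNo (g e ≟ h e))
        still-differs e differs with onCycle? e
        ... | yes _ = ⊥-elim (toWitnessFalse differs refl)
        ... | no _  = differs

      reversed-admissible : Admissible reversed
      reversed-admissible e with onCycle? e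
      ... | yes _ = h-admissible e
      ... | no _  = g-admissible e

      obtainable-after-reversal : ObtainableByCycleReversals G reversed h →
                                  ObtainableByCycleReversals G g h
      obtainable-after-reversal (h* , steps , h*≗h) = h* , reversal-step ◅ steps , h*≗h

    reverse-cycles : ∀ n g → Admissible g → Rearrangement g h → disagreements g < n →
                     ObtainableByCycleReversals G g h
    reverse-cycles zero    _ _ _ ()
    reverse-cycles (suc n) g g-admissible g≈h bounded with any? (λ e → ¬? (g e ≟ h e))
    ... | no agree = g , ε , λ e → decidable-stable (g e ≟ h e) (λ differs → agree (e , differs))
    ... | yes (e₀ , differs) =
      obtainable-after-reversal
        (reverse-cycles n reversed reversed-admissible (rearrangement-trans {reversed} {g} reversed≈g g≈h)
          (≤-trans fewer-disagreements (s≤s⁻¹ bounded)))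
      where
      open Step g g-admissible g≈h e₀ differs

    rearrangement⇒obtainable : ∀ {g} → Admissible g → Rearrangement g h → ObtainableByCycleReversals G g h
    rearrangement⇒obtainable {g} g-admissible g≈h =
      reverse-cycles (suc (disagreements g)) g g-admissible g≈h (n<1+n _)

module _ (G : PlaneGraph) where
  open PlaneGraph G

  module Slots (edges≡ : nE ≡ 3 * nF) (ψ : EdgeInjective G) where
    open EdgeInjective ψ

    uncurry-φ-injective : Injective _≡_ _≡_ (uncurry φ)
    uncurry-φ-injective eq with F≡F′ , i≡i′ ← injective _ _ _ _ eq = cong₂ _,_ F≡F′ i≡i′

    φ-surjective : ∀ e → ∃[ s ] uncurry φ s ≡ e
    φ-surjective = map (remQuot 3) id ∘ injective⇒surjective (trans (*-comm nF 3) (sym edges≡))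
                     {f = uncurry φ ∘ remQuot 3}
                     (λ eq → Injection.injective (↔⇒↣ (*↔× {nF} {3})) (uncurry-φ-injective eq))

    slot : Fin nE → Fin nF × Fin 3
    slot = proj₁ ∘ φ-surjective

    φ-slot : ∀ e → uncurry φ (slot e) ≡ e
    φ-slot = proj₂ ∘ φ-surjective

    dual-head : ∀ {h} → IsDualOrientation G ψ h → ∀ e → h e ≡ proj₁ (slot e)
    dual-head dual e = dual e _ (_ , φ-slot e)

    dual-admissible : ∀ {h} → IsDualOrientation G ψ h → Admissible G h
    dual-admissible dual e =
      subst (T ∘ onFace e) (sym (dual-head dual e))
        (subst (λ e′ → T (onFace e′ (proj₁ (slot e)))) (φ-slot e) (onBdry _ _))

  dual-rearrangement : (edges≡ : nE ≡ 3 * nF) (ψ ψ′ : EdgeInjective G) {h h′ : Orientation G} →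
                       IsDualOrientation G ψ h → IsDualOrientation G ψ′ h′ → Rearrangement G h′ h
  dual-rearrangement edges≡ ψ ψ′ {h} {h′} dual dual′ =
    π , π-injective , λ e → trans (dual′ (π e) _ (_ , refl)) (sym (S.dual-head dual e))
    where
    module S = Slots edges≡ ψ
    module S′ = Slots edges≡ ψ′
    π : Fin nE → Fin nE
    π = uncurry (EdgeInjective.φ ψ′) ∘ S.slot
    π-injective : Injective _≡_ _≡_ π
    π-injective {a} {b} eq =
      trans (sym (S.φ-slot a)) (trans (cong (uncurry (EdgeInjective.φ ψ)) (S′.uncurry-φ-injective eq)) (S.φ-slot b))

lemma4p38 : (G : PlaneGraph) → NoLeaves G → NoProperContractible G →
    PlaneGraph.nE G ≡ 3 * PlaneGraph.nF G →
    (φ φ′ : EdgeInjective G) (h h′ : Orientation G) →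
    IsDualOrientation G φ h → IsDualOrientation G φ′ h′ →
    ObtainableByCycleReversals G h′ h
lemma4p38 G _ _ edges≡ φ φ′ h h′ dual dual′ =
  Reversals.rearrangement⇒obtainable G h (Slots.dual-admissible G edges≡ φ dual)
    (Slots.dual-admissible G edges≡ φ′ dual′) (dual-rearrangement G edges≡ φ φ′ dual dual′)
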